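{- Let $A$ be an alternating sign matrix whose monotone triangle $t_A$ is gapless, and suppose $A$ has a $-1$ in position $(i,j)$, with the first $1$ to its west in row $i$ in position $(i,j_0)$. Then there is no column index $j'$ with $j_0<j'<j$ such that the first nonzero entry of $A$ strictly below row $i$ in column $j'$ exists and equals $1$.
   Context: An alternating sign matrix (ASM) of size $n$ is an $n\times n$ matrix with entries in $\{0,1,-1\}$ such that every row and every column sums to $1$ and the nonzero entries of each row and of each column alternate in sign. Position $(i,j)$ is the $i$-th row from the top and $j$-th column from the left. For an ASM $A$, let $B$ be the matrix with $B_{i,j}=\sum_{k\le i}A_{k,j}$ (a $0$-$1$ matrix); the monotone triangle $t_A$ is the left-aligned triangular array whose $i$-th row (from the top, $i=1,\dots,n$) lists increasingly the column indices $j$ with $B_{i,j}=1$ (it has $i$ entries). The triangle is gapless if, for each of its columns (the $c$-th column consisting of the $c$-th entries of rows $c,\dots,n$), the set of entries is an interval of integers. -}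

module Defs where

open import Data.Nat using (ℕ)
open import Data.Fin using (Fin; toℕ; _<_; _≤_)
open import Data.Fin.Properties using (_≟_)
open import Data.Integer using (ℤ; 0ℤ; 1ℤ; -1ℤ; _+_; -_)
import Data.Integer.Properties as ℤP
open import Data.List using (List; []; _∷_; length; lookup; filter; allFin; map)
open import Data.Product using (Σ; ∃; _×_; _,_)
open import Data.Sum using (_⊎_)
open import Relation.Binary.PropositionalEquality using (_≡_; _≢_)
open import Relation.Nullary using (¬_)
import Data.Fin.Properties as FinP

-- An n×n matrix with integer entries; position (i , j) = row i, column j,
-- indices 0-based (row 0 is the top row, column 0 the leftmost column).
Matrix : ℕ → Set
Matrix n = Fin n → Fin n → ℤ

sumℤ : List ℤ → ℤ
sumℤ []       = 0ℤ
sumℤ (x ∷ xs) = x + sumℤ xs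

rowSum : ∀ {n} → Matrix n → Fin n → ℤ
rowSum {n} A i = sumℤ (map (λ j → A i j) (allFin n))

colSum : ∀ {n} → Matrix n → Fin n → ℤ
colSum {n} A j = sumℤ (map (λ k → A k j) (allFin n))

Alternating : ∀ {n} → (Fin n → ℤ) → Set
Alternating f = ∀ k l → k < l → f k ≢ 0ℤ → f l ≢ 0ℤ →
  (∀ m → k < m → m < l → f m ≡ 0ℤ) → f k ≡ - f l

IsASM : ∀ {n} → Matrix n → Set
IsASM {n} A =
  (∀ i j → A i j ≡ 0ℤ ⊎ (A i j ≡ 1ℤ ⊎ A i j ≡ -1ℤ)) ×
  (∀ i → rowSum A i ≡ 1ℤ) ×
  (∀ j → colSum A j ≡ 1ℤ) ×
  (∀ i → Alternating (λ j → A i j)) ×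
  (∀ j → Alternating (λ k → A k j))

B : ∀ {n} → Matrix n → Fin n → Fin n → ℤ
B {n} A i j = sumℤ (map (λ k → A k j) (filter (λ k → toℕ k Data.Nat.≤? toℕ i) (allFin n)))
  where import Data.Nat

-- row i of the monotone triangle: the increasing list of columns j with B i j = 1
triangleRow : ∀ {n} → Matrix n → Fin n → List (Fin n)
triangleRow {n} A i = filter (λ j → B A i j ℤP.≟ 1ℤ) (allFin n)

-- j is an element of the c-th column (0-based c) of the monotone triangle:
-- it is the c-th entry of some row of the triangle
InTriangleColumn : ∀ {n} → Matrix n → ℕ → Fin n → Set
InTriangleColumn A c j =
  ∃ λ i → Σ (Fin (length (triangleRow A i))) λ p →
    toℕ p ≡ c × lookup (triangleRow A i) p ≡ j

Gapless : ∀ {n} → Matrix n → Set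
Gapless {n} A = ∀ c (a b v : Fin n) →
  InTriangleColumn A c a → InTriangleColumn A c b → a ≤ v → v ≤ b →
  InTriangleColumn A c v

{-# OPTIONS --safe #-}
-- Prefix sums of the rows and columns of an ASM are 0 or 1. Row i of A vanishes strictly between
-- j₀ and j, where its prefix sums are 1, so rows i − 1 and i of B agree there, while B i j₀ = 1 and
-- B (i − 1) j = 1. Induction from j₀ gives B i x = 1 on [j₀, j): if x − 1 is the p-th entry of
-- row i of the monotone triangle, then row i − 1 has p entries < x and its p-th entry lies in
-- [x, j], so gaplessness puts x into column p of the triangle, and comparing the numbers of
-- entries < x and ≤ x along the rows forces x into row i − 1. Finally, since B i j′ = 1, a first
-- nonzero entry 1 below (i, j′) would make a column prefix sum equal to 2.
module Submission where

open import Defs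
open import Data.Nat using (ℕ)
open import Data.Fin using (Fin; _<_)
open import Data.Integer using (ℤ; 0ℤ; 1ℤ; -1ℤ)
open import Data.Product using (∃; _×_)
open import Relation.Binary.PropositionalEquality using (_≡_; _≢_)
open import Relation.Nullary using (¬_)

import Data.Integer.Properties as ℤₚ
open import Algebra.Properties.AbelianGroup ℤₚ.+-0-abelianGroup using (∙-cancelˡ; ∙-cancelʳ)
open import Algebra.Properties.CommutativeSemigroup ℤₚ.+-commutativeSemigroup
  using (interchange; x∙yz≈y∙xz)
open import Data.Bool using (true; false)
open import Data.Empty using (⊥; ⊥-elim)
open import Data.Fin using (zero; suc; toℕ; fromℕ<; _≤_)
open import Data.Fin.Properties using (toℕ-fromℕ<; toℕ<n; toℕ-injective)
open import Data.Integer as ℤ using (+_; _+_; -_; +≤+; -≤+)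
open import Data.List using (List; []; _∷_; length; lookup; filter; tabulate; allFin; map)
open import Data.List.Properties
  using (filter-accept; filter-reject; filter-none; filter-≐; map-tabulate; map-∘)
open import Data.List.Relation.Unary.All using (universal)
open import Data.Nat as ℕ using (zero; suc; z≤n; s≤s; s≤s⁻¹)
open import Data.Nat.Properties
  using (≤-refl; ≤-pred; <⇒≤; <⇒≱; ≮⇒≥; ≰⇒>; <-trans; ≤-<-trans; <-≤-trans;
         n<1+n; n≤1+n; 1+n≰n; m≤m+n; m≤n+m; m<n⇒m<1+n; m≤n⇒m<n∨m≡n; m<1+n⇒m<n∨m≡n)
open import Data.Product using (Σ; _,_; proj₁; proj₂)
open import Data.Sum using (_⊎_; inj₁; inj₂)
open import Function using (_∘_; id)
open import Relation.Binary.PropositionalEquality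
  using (refl; sym; trans; cong; cong₂; subst; subst₂; module ≡-Reasoning)
open import Relation.Nullary using (Dec; yes; no; does)

Bit : ℤ → Set
Bit x = x ≡ 0ℤ ⊎ x ≡ 1ℤ

Trit : ℤ → Set
Trit x = x ≡ 0ℤ ⊎ (x ≡ 1ℤ ⊎ x ≡ -1ℤ)

trit+trit≡1⇒bit : ∀ {s t} → Trit s → Trit t → t + s ≡ 1ℤ → Bit s
trit+trit≡1⇒bit (inj₁ refl)        _                  _  = inj₁ refl
trit+trit≡1⇒bit (inj₂ (inj₁ refl)) _                  _  = inj₂ refl
trit+trit≡1⇒bit (inj₂ (inj₂ refl)) (inj₁ refl)        ()
trit+trit≡1⇒bit (inj₂ (inj₂ refl)) (inj₂ (inj₁ refl)) ()
trit+trit≡1⇒bit (inj₂ (inj₂ refl)) (inj₂ (inj₂ refl)) ()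

trit≢1⇒≤0 : ∀ {x} → Trit x → x ≢ 1ℤ → x ℤ.≤ 0ℤ
trit≢1⇒≤0 (inj₁ refl)        _   = ℤₚ.≤-refl
trit≢1⇒≤0 (inj₂ (inj₁ refl)) x≢1 = ⊥-elim (x≢1 refl)
trit≢1⇒≤0 (inj₂ (inj₂ refl)) _   = -≤+

bit-after-minus-one⇒1 : ∀ {x} → Bit x → Bit (-1ℤ + x) → x ≡ 1ℤ
bit-after-minus-one⇒1 (inj₂ refl) _        = refl
bit-after-minus-one⇒1 (inj₁ refl) (inj₁ ())
bit-after-minus-one⇒1 (inj₁ refl) (inj₂ ())

bit-after-plus-one⇒0 : ∀ {x} → Bit x → Bit (1ℤ + x) → x ≡ 0ℤ
bit-after-plus-one⇒0 (inj₁ refl) _        = refl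
bit-after-plus-one⇒0 (inj₂ refl) (inj₁ ())
bit-after-plus-one⇒0 (inj₂ refl) (inj₂ ())

1≤bit⇒≡1 : ∀ {x} → Bit x → 1ℤ ℤ.≤ x → x ≡ 1ℤ
1≤bit⇒≡1 (inj₁ refl) (+≤+ ())
1≤bit⇒≡1 (inj₂ refl) _ = refl

1+p≤bit+p⇒≡1 : ∀ {b p} → Bit b → + suc p ℤ.≤ b + + p → b ≡ 1ℤ
1+p≤bit+p⇒≡1 (inj₁ refl) le = ⊥-elim (1+n≰n (ℤₚ.drop‿+≤+ le))
1+p≤bit+p⇒≡1 (inj₂ refl) _  = refl

x≤bit+x : ∀ {b} x → Bit b → x ℤ.≤ b + x
x≤bit+x x (inj₁ refl) = ℤₚ.≤-reflexive (sym (ℤₚ.+-identityˡ x))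
x≤bit+x x (inj₂ refl) = ℤₚ.i≤j+i x 1ℤ

interval-induction : ∀ (P : ℕ → Set) {a b} → a ℕ.≤ b → P a →
                     (∀ y → a ℕ.≤ y → y ℕ.< b → P y → P (suc y)) → P b
interval-induction P {b = b} a≤b base step with m≤n⇒m<n∨m≡n a≤b
... | inj₂ refl = base
interval-induction P {b = suc b} a≤b base step | inj₁ a<1+b =
  step b (≤-pred a<1+b) ≤-refl
    (interval-induction P (≤-pred a<1+b) base λ y a≤y y<b → step y a≤y (m<n⇒m<1+n y<b))

psum : (ℕ → ℤ) → ℕ → ℤ
psum f zero    = 0ℤ
psum f (suc y) = f y + psum f y

psum-cong : ∀ {f g} → (∀ y → f y ≡ g y) → ∀ y → psum f y ≡ psum g y
psum-cong f≗g zero    = refl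
psum-cong f≗g (suc y) = cong₂ _+_ (f≗g y) (psum-cong f≗g y)

psum-+ : ∀ f g y → psum (λ z → f z + g z) y ≡ psum f y + psum g y
psum-+ f g zero    = refl
psum-+ f g (suc y) =
  trans (cong (_+_ (f y + g y)) (psum-+ f g y)) (interchange (f y) (g y) (psum f y) (psum g y))

psum-shift : ∀ f y → psum f (suc y) ≡ f 0 + psum (f ∘ suc) y
psum-shift f zero    = refl
psum-shift f (suc y) = trans (cong (_+_ (f (suc y))) (psum-shift f y)) (x∙yz≈y∙xz (f (suc y)) (f 0) _)

psum-constant-on : ∀ {f a b} → a ℕ.≤ b → (∀ y → a ℕ.≤ y → y ℕ.< b → f y ≡ 0ℤ) → psum f b ≡ psum f a
psum-constant-on {f} {a} a≤b zeros = interval-induction (λ y → psum f y ≡ psum f a) a≤b refl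
  λ y a≤y y<b ih → trans (cong₂ _+_ (zeros y a≤y y<b) ih) (ℤₚ.+-identityˡ _)

psum-zero : ∀ {f} → (∀ y → f y ≡ 0ℤ) → ∀ y → psum f y ≡ 0ℤ
psum-zero zeros y = psum-constant-on {b = y} z≤n (λ z _ _ → zeros z)

psum-antitone-on : ∀ {f a b} → a ℕ.≤ b → (∀ y → a ℕ.≤ y → y ℕ.< b → f y ℤ.≤ 0ℤ) →
                   psum f b ℤ.≤ psum f a
psum-antitone-on {f} {a} a≤b nonpos =
  interval-induction (λ y → psum f y ℤ.≤ psum f a) a≤b ℤₚ.≤-refl λ y a≤y y<b ih → ℤₚ.≤-trans (ℤₚ.+-monoˡ-≤ (psum f y) (nonpos y a≤y y<b))
                              (ℤₚ.≤-trans (ℤₚ.≤-reflexive (ℤₚ.+-identityˡ _)) ih)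

AlternatingSeq : (ℕ → ℤ) → Set
AlternatingSeq f = ∀ k l → k ℕ.< l → f k ≢ 0ℤ → f l ≢ 0ℤ →
  (∀ m → k ℕ.< m → m ℕ.< l → f m ≡ 0ℤ) → f k ≡ - f l

module _ {f : ℕ → ℤ} where

  LastNonzeroBefore : ℕ → ℕ → Set
  LastNonzeroBefore b k = k ℕ.< b × f k ≢ 0ℤ × (∀ m → k ℕ.< m → m ℕ.< b → f m ≡ 0ℤ)

  ZeroOrLastNonzero : ℕ → ℕ → Set
  ZeroOrLastNonzero a b =
    psum f b ≡ psum f a ⊎ ∃ λ k → LastNonzeroBefore b k × psum f b ≡ f k + psum f a

  alternating-zeroOrLastNonzero : AlternatingSeq f → ∀ {a b} → a ℕ.≤ b → ZeroOrLastNonzero a b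
  alternating-zeroOrLastNonzero alt {a} a≤b =
    interval-induction (ZeroOrLastNonzero a) a≤b (inj₁ refl) extend
    where
    open ≡-Reasoning

    extend : ∀ y → a ℕ.≤ y → y ℕ.< _ → ZeroOrLastNonzero a y → ZeroOrLastNonzero a (suc y)
    extend y _ _ s with f y ℤₚ.≟ 0ℤ
    extend y _ _ (inj₁ e) | yes fy≡0 = inj₁ (trans (cong₂ _+_ fy≡0 e) (ℤₚ.+-identityˡ _))
    extend y _ _ (inj₂ (k , (k<y , fk≢0 , zeros) , e)) | yes fy≡0 =
      inj₂ (k , (m<n⇒m<1+n k<y , fk≢0 , zeros′) , trans (cong₂ _+_ fy≡0 e) (ℤₚ.+-identityˡ _))
      where
      zeros′ : ∀ m → k ℕ.< m → m ℕ.< suc y → f m ≡ 0ℤ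
      zeros′ m k<m m<1+y with m<1+n⇒m<n∨m≡n m<1+y
      ... | inj₁ m<y  = zeros m k<m m<y
      ... | inj₂ refl = fy≡0
    extend y _ _ (inj₁ e) | no fy≢0 =
      inj₂ (y , (≤-refl , fy≢0 , λ m y<m m<1+y → ⊥-elim (<⇒≱ y<m (≤-pred m<1+y))) ,
            cong (_+_ (f y)) e)
    extend y _ _ (inj₂ (k , (k<y , fk≢0 , zeros) , e)) | no fy≢0 = inj₁ (begin
      f y + psum f y           ≡⟨ cong (_+_ (f y)) e ⟩
      f y + (f k + psum f a)   ≡⟨ cong (λ v → f y + (v + psum f a)) (alt k y k<y fk≢0 fy≢0 zeros) ⟩
      f y + (- f y + psum f a) ≡⟨ sym (ℤₚ.+-assoc (f y) (- f y) _) ⟩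
      f y + - f y + psum f a   ≡⟨ cong (_+ psum f a) (ℤₚ.+-inverseʳ (f y)) ⟩
      0ℤ + psum f a            ≡⟨ ℤₚ.+-identityˡ _ ⟩
      psum f a                 ∎)

  alternating-segment-trit : (∀ y → Trit (f y)) → AlternatingSeq f → ∀ {a b} → a ℕ.≤ b →
                             ∃ λ s → Trit s × psum f b ≡ s + psum f a
  alternating-segment-trit trit alt a≤b with alternating-zeroOrLastNonzero alt a≤b
  ... | inj₁ e           = 0ℤ , inj₁ refl , trans e (sym (ℤₚ.+-identityˡ _))
  ... | inj₂ (k , _ , e) = f k , trit k , e

  -- psum f y and the sum from y on are trits adding up to 1, so psum f y is not -1.
  alternating-psum-bit : (∀ y → Trit (f y)) → AlternatingSeq f → ∀ N → (∀ y → N ℕ.≤ y → f y ≡ 0ℤ) →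
                         psum f N ≡ 1ℤ → ∀ y → Bit (psum f y)
  alternating-psum-bit trit alt N beyond total y
    with alternating-segment-trit trit alt (z≤n {y}) | alternating-segment-trit trit alt (m≤m+n y N)
  ... | s , s-trit , before | t , t-trit , after =
    subst Bit (sym before′) (trit+trit≡1⇒bit s-trit t-trit (begin
      t + s            ≡⟨ cong (_+_ t) (sym before′) ⟩
      t + psum f y     ≡⟨ sym after ⟩
      psum f (y ℕ.+ N) ≡⟨ psum-constant-on (m≤n+m N y) (λ z N≤z _ → beyond z N≤z) ⟩
      psum f N         ≡⟨ total ⟩
      1ℤ               ∎))
    where
    open ≡-Reasoning
    before′ : psum f y ≡ s
    before′ = trans before (ℤₚ.+-identityʳ s)

  first-one-between : (∀ y → Bit (f y)) → ∀ {a b} → a ℕ.≤ b → f b ≡ 1ℤ →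
    ∃ λ c → a ℕ.≤ c × c ℕ.≤ b × f c ≡ 1ℤ × psum f c ≡ psum f a
  first-one-between bit {a} {b} a≤b fb≡1 = conclude (interval-induction Search a≤b (inj₁ refl) step)
    where
    Search : ℕ → Set
    Search y = psum f y ≡ psum f a ⊎ ∃ λ c → a ℕ.≤ c × c ℕ.< y × f c ≡ 1ℤ × psum f c ≡ psum f a

    step : ∀ y → a ℕ.≤ y → y ℕ.< b → Search y → Search (suc y)
    step y a≤y _ (inj₁ e) with bit y
    ... | inj₁ fy≡0 = inj₁ (trans (cong₂ _+_ fy≡0 e) (ℤₚ.+-identityˡ _))
    ... | inj₂ fy≡1 = inj₂ (y , a≤y , ≤-refl , fy≡1 , e)
    step y _ _ (inj₂ (c , a≤c , c<y , found)) = inj₂ (c , a≤c , m<n⇒m<1+n c<y , found)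

    conclude : Search b → ∃ λ c → a ℕ.≤ c × c ℕ.≤ b × f c ≡ 1ℤ × psum f c ≡ psum f a
    conclude (inj₁ e)                          = b , a≤b , ≤-refl , fb≡1 , e
    conclude (inj₂ (c , a≤c , c<b , fc≡1 , e)) = c , a≤c , <⇒≤ c<b , fc≡1 , e

  -- The prefix sum at b is 1 because adding the -1 at b keeps it a bit, and on [a, b) the
  -- prefix sums can only decrease.
  psum≡1-before-minus-one : (∀ y → Trit (f y)) → (∀ y → Bit (psum f y)) → ∀ {a b} → f b ≡ -1ℤ →
    a ℕ.≤ b → (∀ y → a ℕ.≤ y → y ℕ.< b → f y ≢ 1ℤ) → psum f a ≡ 1ℤ
  psum≡1-before-minus-one trit bit {a} {b} fb≡-1 a≤b no-one =
    1≤bit⇒≡1 (bit a) (subst (ℤ._≤ psum f a) psum-b≡1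
      (psum-antitone-on a≤b λ y a≤y y<b → trit≢1⇒≤0 (trit y) (no-one y a≤y y<b)))
    where
    psum-b≡1 : psum f b ≡ 1ℤ
    psum-b≡1 = bit-after-minus-one⇒1 (bit b)
                 (subst Bit (cong (λ v → v + psum f b) fb≡-1) (bit (suc b)))

zeroExtend : ∀ {n} → (Fin n → ℤ) → ℕ → ℤ
zeroExtend {zero}  g y       = 0ℤ
zeroExtend {suc n} g zero    = g zero
zeroExtend {suc n} g (suc y) = zeroExtend (g ∘ suc) y

zeroExtend-toℕ : ∀ {n} (g : Fin n → ℤ) k → zeroExtend g (toℕ k) ≡ g k
zeroExtend-toℕ g zero    = refl
zeroExtend-toℕ g (suc k) = zeroExtend-toℕ (g ∘ suc) k

zeroExtend-beyond : ∀ {n} (g : Fin n → ℤ) {y} → n ℕ.≤ y → zeroExtend g y ≡ 0ℤ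
zeroExtend-beyond {zero}  g _                = refl
zeroExtend-beyond {suc n} g {suc y} (s≤s n≤y) = zeroExtend-beyond (g ∘ suc) n≤y

zeroExtend-cong : ∀ {n} {g h : Fin n → ℤ} → (∀ k → g k ≡ h k) →
                  ∀ y → zeroExtend g y ≡ zeroExtend h y
zeroExtend-cong {zero}  g≗h y       = refl
zeroExtend-cong {suc n} g≗h zero    = g≗h zero
zeroExtend-cong {suc n} g≗h (suc y) = zeroExtend-cong (g≗h ∘ suc) y

zeroExtend-all : ∀ {n} {g : Fin n → ℤ} (P : ℤ → Set) → P 0ℤ → (∀ k → P (g k)) →
                 ∀ y → P (zeroExtend g y)
zeroExtend-all {zero}  P p0 pg y       = p0
zeroExtend-all {suc n} P p0 pg zero    = pg zero
zeroExtend-all {suc n} P p0 pg (suc y) = zeroExtend-all P p0 (pg ∘ suc) y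

toℕ-preimage : ∀ {n y} → y ℕ.< n → ∃ λ (k : Fin n) → toℕ k ≡ y
toℕ-preimage y<n = fromℕ< y<n , toℕ-fromℕ< y<n

toℕ-preimage-or-beyond : ∀ n y → (∃ λ (k : Fin n) → toℕ k ≡ y) ⊎ n ℕ.≤ y
toℕ-preimage-or-beyond n y with y ℕ.<? n
... | yes y<n = inj₁ (toℕ-preimage y<n)
... | no  y≮n = inj₂ (≮⇒≥ y≮n)

alternating-zeroExtend : ∀ {n} {g : Fin n → ℤ} → Alternating g → AlternatingSeq (zeroExtend g)
alternating-zeroExtend {n} {g} alt k l k<l gk≢0 gl≢0 zeros
  with toℕ-preimage-or-beyond n k | toℕ-preimage-or-beyond n l
... | inj₂ n≤k | _        = ⊥-elim (gk≢0 (zeroExtend-beyond g n≤k))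
... | inj₁ _   | inj₂ n≤l = ⊥-elim (gl≢0 (zeroExtend-beyond g n≤l))
... | inj₁ (k′ , refl) | inj₁ (l′ , refl) = begin
  zeroExtend g (toℕ k′)     ≡⟨ ext k′ ⟩
  g k′                      ≡⟨ alt k′ l′ k<l (gk≢0 ∘ trans (ext k′)) (gl≢0 ∘ trans (ext l′))
                                 (λ m k′<m m<l′ → trans (sym (ext m)) (zeros (toℕ m) k′<m m<l′)) ⟩
  - g l′                    ≡⟨ cong -_ (sym (ext l′)) ⟩
  - zeroExtend g (toℕ l′)   ∎
  where
  open ≡-Reasoning
  ext : ∀ k → zeroExtend g (toℕ k) ≡ g k
  ext = zeroExtend-toℕ g

sum-tabulate : ∀ {n} (g : Fin n → ℤ) → sumℤ (tabulate g) ≡ psum (zeroExtend g) n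
sum-tabulate {zero}  g = refl
sum-tabulate {suc n} g =
  trans (cong (_+_ (g zero)) (sum-tabulate (g ∘ suc))) (sym (psum-shift (zeroExtend g) n))

sum-allFin : ∀ {n} (g : Fin n → ℤ) → sumℤ (map g (allFin n)) ≡ psum (zeroExtend g) n
sum-allFin g = trans (cong sumℤ (map-tabulate id g)) (sum-tabulate g)

filter-map : ∀ {A B : Set} {P : B → Set} (P? : ∀ y → Dec (P y)) (f : A → B) xs →
             filter P? (map f xs) ≡ map f (filter (P? ∘ f) xs)
filter-map P? f []       = refl
filter-map P? f (x ∷ xs) with does (P? (f x))
... | true  = cong (f x ∷_) (filter-map P? f xs)
... | false = filter-map P? f xs

sum-filter-prefix : ∀ {n} (g : Fin n → ℤ) t →
  sumℤ (map g (filter (λ k → toℕ k ℕ.≤? t) (allFin n))) ≡ psum (zeroExtend g) (suc t)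
sum-filter-prefix {zero}  g t = sym (psum-zero (λ _ → refl) (suc t))
sum-filter-prefix {suc n} g t = begin
  g zero + sumℤ (map g (filter P (tabulate suc)))
    ≡⟨ cong (λ xs → g zero + sumℤ (map g (filter P xs))) (sym (map-tabulate id suc)) ⟩
  g zero + sumℤ (map g (filter P (map suc (allFin n))))
    ≡⟨ cong (λ xs → g zero + sumℤ (map g xs)) (filter-map P suc (allFin n)) ⟩
  g zero + sumℤ (map g (map suc (filter (P ∘ suc) (allFin n))))
    ≡⟨ cong (λ v → g zero + sumℤ v) (sym (map-∘ (filter (P ∘ suc) (allFin n)))) ⟩
  g zero + sumℤ (map (g ∘ suc) (filter (P ∘ suc) (allFin n)))
    ≡⟨ cong (_+_ (g zero)) (tail t) ⟩
  g zero + psum (zeroExtend (g ∘ suc)) t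
    ≡⟨ sym (psum-shift (zeroExtend g) t) ⟩
  psum (zeroExtend g) (suc t) ∎
  where
  open ≡-Reasoning
  P : ∀ (k : Fin (suc n)) → Dec (toℕ k ℕ.≤ t)
  P k = toℕ k ℕ.≤? t

  tail : ∀ u → sumℤ (map (g ∘ suc) (filter (λ k → suc (toℕ k) ℕ.≤? u) (allFin n))) ≡
               psum (zeroExtend (g ∘ suc)) u
  tail zero    = cong (sumℤ ∘ map (g ∘ suc))
                      (filter-none (λ k → suc (toℕ k) ℕ.≤? 0) (universal (λ _ ()) (allFin n)))
  tail (suc u) = trans (cong (sumℤ ∘ map (g ∘ suc)) (filter-≐ _ _ (s≤s⁻¹ , s≤s) (allFin n)))
                       (sum-filter-prefix (g ∘ suc) u)

alternating-prefix-bit : ∀ {n} {g : Fin n → ℤ} → (∀ k → Trit (g k)) → Alternating g →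
                         sumℤ (map g (allFin n)) ≡ 1ℤ → ∀ y → Bit (psum (zeroExtend g) y)
alternating-prefix-bit {n} {g} trit alt total =
  alternating-psum-bit (zeroExtend-all Trit (inj₁ refl) trit) (alternating-zeroExtend alt) n
                       (λ _ → zeroExtend-beyond g) (trans (sym (sum-allFin g)) total)

OccursAt : ∀ {X : Set} → List X → ℕ → X → Set
OccursAt xs c x = Σ (Fin (length xs)) λ p → toℕ p ≡ c × lookup xs p ≡ x

occursAt-there : ∀ {X : Set} {xs : List X} {y c x} → OccursAt xs c x → OccursAt (y ∷ xs) (suc c) x
occursAt-there (p , refl , e) = suc p , refl , e

module _ {N} (g : Fin N → ℤ) (g-bit : ∀ x → Bit (g x)) where

  onesOf : ∀ {m} → (Fin m → Fin N) → List (Fin N)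
  onesOf h = filter (λ x → g x ℤₚ.≟ 1ℤ) (tabulate h)

  private
    onesOf-one : ∀ {m} (h : Fin (suc m) → Fin N) → g (h zero) ≡ 1ℤ →
                 onesOf h ≡ h zero ∷ onesOf (h ∘ suc)
    onesOf-one h = filter-accept (λ x → g x ℤₚ.≟ 1ℤ)

    onesOf-zero : ∀ {m} (h : Fin (suc m) → Fin N) → g (h zero) ≡ 0ℤ → onesOf h ≡ onesOf (h ∘ suc)
    onesOf-zero h g≡0 = filter-reject (λ x → g x ℤₚ.≟ 1ℤ) (λ g≡1 → 0≢1 (trans (sym g≡0) g≡1))
      where
      0≢1 : 0ℤ ≢ 1ℤ
      0≢1 ()

  occursAt-onesOf⁻ : ∀ {m} (h : Fin m → Fin N) (f : ℕ → ℤ) → (∀ k → f (toℕ k) ≡ g (h k)) →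
    ∀ {c x} → OccursAt (onesOf h) c x → ∃ λ k → h k ≡ x × g x ≡ 1ℤ × psum f (toℕ k) ≡ + c
  occursAt-onesOf⁻ {zero} h f agree (() , _)
  occursAt-onesOf⁻ {suc m} h f agree {c} {x} occ with g-bit (h zero)
  ... | inj₂ g≡1 with subst (λ xs → OccursAt xs c x) (onesOf-one h g≡1) occ
  ...   | zero , refl , refl = zero , refl , g≡1 , refl
  ...   | suc p , refl , e with occursAt-onesOf⁻ (h ∘ suc) (f ∘ suc) (agree ∘ suc) (p , refl , e)
  ...     | k , hk≡x , gx≡1 , s =
    suc k , hk≡x , gx≡1 , trans (psum-shift f (toℕ k)) (cong₂ _+_ (trans (agree zero) g≡1) s)
  occursAt-onesOf⁻ {suc m} h f agree {c} {x} occ | inj₁ g≡0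
    with occursAt-onesOf⁻ (h ∘ suc) (f ∘ suc) (agree ∘ suc)
                          (subst (λ xs → OccursAt xs c x) (onesOf-zero h g≡0) occ)
  ... | k , hk≡x , gx≡1 , s =
    suc k , hk≡x , gx≡1 , trans (psum-shift f (toℕ k)) (cong₂ _+_ (trans (agree zero) g≡0) s)

  occursAt-onesOf⁺ : ∀ {m} (h : Fin m → Fin N) (f : ℕ → ℤ) → (∀ k → f (toℕ k) ≡ g (h k)) →
    ∀ k → g (h k) ≡ 1ℤ → ∃ λ c → OccursAt (onesOf h) c (h k) × psum f (toℕ k) ≡ + c
  occursAt-onesOf⁺ h f agree zero g≡1 =
    0 , subst (λ xs → OccursAt xs 0 (h zero)) (sym (onesOf-one h g≡1)) (zero , refl , refl) , refl
  occursAt-onesOf⁺ h f agree (suc k) ghk≡1 with g-bit (h zero)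
    | occursAt-onesOf⁺ (h ∘ suc) (f ∘ suc) (agree ∘ suc) k ghk≡1
  ... | inj₂ g≡1 | c , occ , s =
    suc c , subst (λ xs → OccursAt xs (suc c) (h (suc k))) (sym (onesOf-one h g≡1)) (occursAt-there occ) ,
    trans (psum-shift f (toℕ k)) (cong₂ _+_ (trans (agree zero) g≡1) s)
  ... | inj₁ g≡0 | c , occ , s =
    c , subst (λ xs → OccursAt xs c (h (suc k))) (sym (onesOf-zero h g≡0)) occ ,
    trans (psum-shift f (toℕ k)) (cong₂ _+_ (trans (agree zero) g≡0) s)

-- Rows and columns are indexed by ℕ, with A extended by zeros. Row i of B is
-- colPrefix A (suc i), and onesBefore A (suc i) c is the number of entries < c in
-- row i of the monotone triangle.
entry : ∀ {n} → Matrix n → ℕ → ℕ → ℤ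
entry A r c = zeroExtend (λ i → zeroExtend (A i) c) r

colPrefix : ∀ {n} → Matrix n → ℕ → ℕ → ℤ
colPrefix A r c = psum (λ r′ → entry A r′ c) r

rowPrefix : ∀ {n} → Matrix n → ℕ → ℕ → ℤ
rowPrefix A r = psum (entry A r)

onesBefore : ∀ {n} → Matrix n → ℕ → ℕ → ℤ
onesBefore A r = psum (colPrefix A r)

module _ {n} (A : Matrix n) where

  entry-row : ∀ (i : Fin n) c → entry A (toℕ i) c ≡ zeroExtend (A i) c
  entry-row i c = zeroExtend-toℕ (λ i → zeroExtend (A i) c) i

  entry-col : ∀ r (j : Fin n) → entry A r (toℕ j) ≡ zeroExtend (λ i → A i j) r
  entry-col r j = zeroExtend-cong (λ i → zeroExtend-toℕ (A i) j) r

  entry-toℕ : ∀ i j → entry A (toℕ i) (toℕ j) ≡ A i j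
  entry-toℕ i j = trans (entry-row i (toℕ j)) (zeroExtend-toℕ (A i) j)

  entry-beyond-row : ∀ {r} c → n ℕ.≤ r → entry A r c ≡ 0ℤ
  entry-beyond-row c = zeroExtend-beyond _

  entry-beyond-col : ∀ r {c} → n ℕ.≤ c → entry A r c ≡ 0ℤ
  entry-beyond-col r n≤c = zeroExtend-all (_≡ 0ℤ) refl (λ i → zeroExtend-beyond (A i) n≤c) r

  B≡colPrefix : ∀ i j → B A i j ≡ colPrefix A (suc (toℕ i)) (toℕ j)
  B≡colPrefix i j =
    trans (sum-filter-prefix (λ k → A k j) (toℕ i)) (sym (psum-cong (λ r → entry-col r j) (suc (toℕ i))))

  onesBefore-suc : ∀ r c → onesBefore A (suc r) c ≡ rowPrefix A r c + onesBefore A r c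
  onesBefore-suc r = psum-+ (entry A r) (colPrefix A r)

module _ {n} {A : Matrix n} (asm : IsASM A) where

  private
    trit : ∀ i j → Trit (A i j)
    trit = proj₁ asm

    rowSum≡1 : ∀ i → rowSum A i ≡ 1ℤ
    rowSum≡1 = proj₁ (proj₂ asm)

    colSum≡1 : ∀ j → colSum A j ≡ 1ℤ
    colSum≡1 = proj₁ (proj₂ (proj₂ asm))

    row-alternating : ∀ i → Alternating (λ j → A i j)
    row-alternating = proj₁ (proj₂ (proj₂ (proj₂ asm)))

    col-alternating : ∀ j → Alternating (λ i → A i j)
    col-alternating = proj₂ (proj₂ (proj₂ (proj₂ asm)))

  entry-trit : ∀ r c → Trit (entry A r c)
  entry-trit r c = zeroExtend-all Trit (inj₁ refl) (λ i → zeroExtend-all Trit (inj₁ refl) (trit i) c) r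

  colPrefix-bit : ∀ r c → Bit (colPrefix A r c)
  colPrefix-bit r c with toℕ-preimage-or-beyond n c
  ... | inj₁ (j , refl) = subst Bit (sym (psum-cong (λ r′ → entry-col A r′ j) r))
                                    (alternating-prefix-bit (λ i → trit i j) (col-alternating j) (colSum≡1 j) r)
  ... | inj₂ n≤c        = subst Bit (sym (psum-zero (λ r′ → entry-beyond-col A r′ n≤c) r)) (inj₁ refl)

  rowPrefix-bit : ∀ r c → Bit (rowPrefix A r c)
  rowPrefix-bit r c with toℕ-preimage-or-beyond n r
  ... | inj₁ (i , refl) = subst Bit (sym (psum-cong (entry-row A i) c))
                                    (alternating-prefix-bit (trit i) (row-alternating i) (rowSum≡1 i) c)
  ... | inj₂ n≤r        = subst Bit (sym (psum-zero (λ c′ → entry-beyond-row A c′ n≤r) c)) (inj₁ refl)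

  onesBefore-mono : ∀ {r r′} c → r ℕ.≤ r′ → onesBefore A r c ℤ.≤ onesBefore A r′ c
  onesBefore-mono {r} c r≤r′ =
    interval-induction (λ z → onesBefore A r c ℤ.≤ onesBefore A z c) r≤r′ ℤₚ.≤-refl λ z _ _ ih →
      ℤₚ.≤-trans ih (subst (onesBefore A z c ℤ.≤_) (sym (onesBefore-suc A z c))
                           (x≤bit+x _ (rowPrefix-bit z c)))

  private
    B-bit : ∀ i j → Bit (B A i j)
    B-bit i j = subst Bit (sym (B≡colPrefix A i j)) (colPrefix-bit _ _)

  inTriangleColumn-intro : ∀ i x → colPrefix A (suc (toℕ i)) (toℕ x) ≡ 1ℤ →
    ∃ λ c → onesBefore A (suc (toℕ i)) (toℕ x) ≡ + c × InTriangleColumn A c x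
  inTriangleColumn-intro i x B≡1
    with occursAt-onesOf⁺ (B A i) (B-bit i) id _ (sym ∘ B≡colPrefix A i) x (trans (B≡colPrefix A i x) B≡1)
  ... | c , occ , count = c , count , i , occ

  inTriangleColumn-elim : ∀ {c x} → InTriangleColumn A c x →
    ∃ λ i → colPrefix A (suc (toℕ i)) (toℕ x) ≡ 1ℤ × onesBefore A (suc (toℕ i)) (toℕ x) ≡ + c
  inTriangleColumn-elim (i , occ) with occursAt-onesOf⁻ (B A i) (B-bit i) id _ (sym ∘ B≡colPrefix A i) occ
  ... | x , refl , B≡1 , count = i , trans (sym (B≡colPrefix A i x)) B≡1 , count

  -- x sits in column c of a triangle row m with c entries < x, so m lies above the row with
  -- c + 1 entries < x; then row r − 1 has at least m's c + 1 entries ≤ x, but only c entries < x.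
  inTriangleColumn⇒colPrefix≡1 : ∀ {r c} (x : Fin n) → InTriangleColumn A c x →
    onesBefore A r (toℕ x) ≡ + c → onesBefore A (suc r) (toℕ x) ≡ + suc c → colPrefix A r (toℕ x) ≡ 1ℤ
  inTriangleColumn⇒colPrefix≡1 {r} x x∈c above below with inTriangleColumn-elim x∈c
  ... | i , Bi≡1 , Ci≡c with suc (toℕ i) ℕ.≤? r
  ...   | yes i<r = 1+p≤bit+p⇒≡1 (colPrefix-bit r (toℕ x))
                      (subst₂ ℤ._≤_ (cong₂ _+_ Bi≡1 Ci≡c) (cong (_+_ (colPrefix A r (toℕ x))) above)
                              (onesBefore-mono (suc (toℕ x)) i<r))
  ...   | no  i≮r = ⊥-elim (1+n≰n (ℤₚ.drop‿+≤+
                      (subst₂ ℤ._≤_ below Ci≡c (onesBefore-mono (toℕ x) (≰⇒> i≮r)))))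

  inTriangleColumn-at-or-after : ∀ r (x y : Fin n) {p} → r ℕ.≤ n → x ≤ y → colPrefix A r (toℕ y) ≡ 1ℤ →
    onesBefore A r (toℕ x) ≡ + p → ∃ λ b → x ≤ b × InTriangleColumn A p b
  inTriangleColumn-at-or-after (suc r) x y r<n x≤y By≡1 Cx≡p with toℕ-preimage r<n
  ... | i , refl with first-one-between (colPrefix-bit (suc (toℕ i))) x≤y By≡1
  ... | b , x≤b , b≤y , Bb≡1 , Cb≡Cx with toℕ-preimage (≤-<-trans b≤y (toℕ<n y))
  ... | xb , refl with inTriangleColumn-intro i xb Bb≡1
  ... | q , Cb≡q , xb∈q =
    xb , x≤b ,
    subst (λ c → InTriangleColumn A c xb) (ℤₚ.+-injective (trans (sym Cb≡q) (trans Cb≡Cx Cx≡p))) xb∈q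

  first-nonzero-below-not-one : ∀ {i k : Fin n} j → colPrefix A (suc (toℕ i)) (toℕ j) ≡ 1ℤ → i < k →
    A k j ≡ 1ℤ → (∀ m → i < m → m < k → A m j ≡ 0ℤ) → ⊥
  first-nonzero-below-not-one {i} {k} j Bi≡1 i<k Akj≡1 zeros = 1≢0 (trans (sym Bk≡1) Bk≡0)
    where
    1≢0 : 1ℤ ≢ 0ℤ
    1≢0 ()

    zero-between : ∀ y → suc (toℕ i) ℕ.≤ y → y ℕ.< toℕ k → entry A y (toℕ j) ≡ 0ℤ
    zero-between y i<y y<k with toℕ-preimage (<-trans y<k (toℕ<n k))
    ... | m , refl = trans (entry-toℕ A m j) (zeros m i<y y<k)

    Bk≡1 : colPrefix A (toℕ k) (toℕ j) ≡ 1ℤ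
    Bk≡1 = trans (psum-constant-on i<k zero-between) Bi≡1

    Bk≡0 : colPrefix A (toℕ k) (toℕ j) ≡ 0ℤ
    Bk≡0 = bit-after-plus-one⇒0 (colPrefix-bit (toℕ k) (toℕ j))
             (subst Bit (cong (λ v → v + colPrefix A (toℕ k) (toℕ j)) (trans (entry-toℕ A k j) Akj≡1))
                    (colPrefix-bit (suc (toℕ k)) (toℕ j)))

module _ {n} {A : Matrix n} (asm : IsASM A) (gapless : Gapless A) {i j j₀ : Fin n}
         (Aij≡-1 : A i j ≡ -1ℤ) (Aij₀≡1 : A i j₀ ≡ 1ℤ)
         (no-one : ∀ m → j₀ < m → m < j → A i m ≢ 1ℤ) where

  private
    r : ℕ
    r = toℕ i

    row-no-one : ∀ y → toℕ j₀ ℕ.< y → y ℕ.< toℕ j → entry A r y ≢ 1ℤ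
    row-no-one y j₀<y y<j with toℕ-preimage (<-trans y<j (toℕ<n j))
    ... | m , refl = no-one m j₀<y y<j ∘ trans (sym (entry-toℕ A i m))

    row-prefix≡1 : ∀ y → toℕ j₀ ℕ.< y → y ℕ.≤ toℕ j → rowPrefix A r y ≡ 1ℤ
    row-prefix≡1 y j₀<y y≤j =
      psum≡1-before-minus-one (entry-trit asm r) (rowPrefix-bit asm r)
                              (trans (entry-toℕ A i j) Aij≡-1) y≤j λ z y≤z z<j → row-no-one z (<-≤-trans j₀<y y≤z) z<j

    row-zero : ∀ y → toℕ j₀ ℕ.< y → y ℕ.< toℕ j → entry A r y ≡ 0ℤ
    row-zero y j₀<y y<j = ∙-cancelʳ 1ℤ (entry A r y) 0ℤ
      (trans (cong (_+_ (entry A r y)) (sym (row-prefix≡1 y j₀<y (<⇒≤ y<j))))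
             (row-prefix≡1 (suc y) (m<n⇒m<1+n j₀<y) y<j))

    colPrefix-next : ∀ x → colPrefix A (suc r) (toℕ x) ≡ A i x + colPrefix A r (toℕ x)
    colPrefix-next x = cong (λ v → v + colPrefix A r (toℕ x)) (entry-toℕ A i x)

    colPrefix-above-j : colPrefix A r (toℕ j) ≡ 1ℤ
    colPrefix-above-j = bit-after-minus-one⇒1 (colPrefix-bit asm r (toℕ j))
      (subst Bit (trans (colPrefix-next j) (cong (λ v → v + colPrefix A r (toℕ j)) Aij≡-1))
             (colPrefix-bit asm (suc r) (toℕ j)))

    colPrefix-at-j₀ : colPrefix A (suc r) (toℕ j₀) ≡ 1ℤ
    colPrefix-at-j₀ = trans (colPrefix-next j₀) (cong₂ _+_ Aij₀≡1 B-above-j₀≡0)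
      where
      B-above-j₀≡0 : colPrefix A r (toℕ j₀) ≡ 0ℤ
      B-above-j₀≡0 = bit-after-plus-one⇒0 (colPrefix-bit asm r (toℕ j₀))
        (subst Bit (trans (colPrefix-next j₀) (cong (λ v → v + colPrefix A r (toℕ j₀)) Aij₀≡1))
               (colPrefix-bit asm (suc r) (toℕ j₀)))

    onesBefore-above : ∀ (x : Fin n) {p} → j₀ < x → x < j → onesBefore A (suc r) (toℕ x) ≡ + suc p →
                       onesBefore A r (toℕ x) ≡ + p
    onesBefore-above x j₀<x x<j below = ∙-cancelˡ 1ℤ _ _ (begin
      1ℤ + onesBefore A r (toℕ x)
        ≡⟨ cong (λ v → v + onesBefore A r (toℕ x)) (sym (row-prefix≡1 (toℕ x) j₀<x (<⇒≤ x<j))) ⟩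
      rowPrefix A r (toℕ x) + onesBefore A r (toℕ x)
        ≡⟨ sym (onesBefore-suc A r (toℕ x)) ⟩
      onesBefore A (suc r) (toℕ x)
        ≡⟨ below ⟩
      + suc _ ∎)
      where open ≡-Reasoning

    B-row≡1-step : ∀ (xc x : Fin n) → toℕ x ≡ suc (toℕ xc) → j₀ ≤ xc → x < j →
                   colPrefix A (suc r) (toℕ xc) ≡ 1ℤ → colPrefix A (suc r) (toℕ x) ≡ 1ℤ
    B-row≡1-step xc x x≡ j₀≤xc x<j Bxc≡1 with inTriangleColumn-intro asm i xc Bxc≡1
    ... | p , Cxc≡p , xc∈p =
      cong₂ _+_ (row-zero (toℕ x) j₀<x x<j) (inTriangleColumn⇒colPrefix≡1 asm x x∈p above below)
      where
      j₀<x : j₀ < x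
      j₀<x = subst (toℕ j₀ ℕ.<_) (sym x≡) (s≤s j₀≤xc)

      below : onesBefore A (suc r) (toℕ x) ≡ + suc p
      below = subst (λ y → onesBefore A (suc r) y ≡ + suc p) (sym x≡) (cong₂ _+_ Bxc≡1 Cxc≡p)

      above : onesBefore A r (toℕ x) ≡ + p
      above = onesBefore-above x j₀<x x<j below

      x∈p : InTriangleColumn A p x
      x∈p with inTriangleColumn-at-or-after asm r x j (<⇒≤ (toℕ<n i)) (<⇒≤ x<j) colPrefix-above-j above
      ... | b , x≤b , b∈p = gapless p xc b x xc∈p b∈p (subst (toℕ xc ℕ.≤_) (sym x≡) (n≤1+n _)) x≤b

  B-row≡1-between : ∀ (x : Fin n) → j₀ ≤ x → x < j → colPrefix A (suc r) (toℕ x) ≡ 1ℤ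
  B-row≡1-between x j₀≤x = interval-induction P j₀≤x base step x refl
    where
    P : ℕ → Set
    P c = ∀ x′ → toℕ x′ ≡ c → x′ < j → colPrefix A (suc r) (toℕ x′) ≡ 1ℤ

    base : P (toℕ j₀)
    base x′ x′≡j₀ _ rewrite toℕ-injective x′≡j₀ = colPrefix-at-j₀

    pred< : ∀ {c} (x′ : Fin n) → toℕ x′ ≡ suc c → c ℕ.< toℕ x′
    pred< x′ x′≡1+c = subst (_ ℕ.<_) (sym x′≡1+c) (n<1+n _)

    step : ∀ c → toℕ j₀ ℕ.≤ c → c ℕ.< toℕ x → P c → P (suc c)
    step c j₀≤c _ ih x′ x′≡1+c x′<j with toℕ-preimage (<-trans (pred< x′ x′≡1+c) (toℕ<n x′))
    ... | xc , refl =
      B-row≡1-step xc x′ x′≡1+c j₀≤c x′<j (ih xc refl (<-trans (pred< x′ x′≡1+c) x′<j))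

-- The hypothesis j₀ < j is implied by j₀ < j′ < j.
lemma3p6 : ∀ {n} (A : Matrix n) → IsASM A → Gapless A →
    ∀ (i j j₀ : Fin n) → A i j ≡ -1ℤ →
    j₀ < j → A i j₀ ≡ 1ℤ → (∀ m → j₀ < m → m < j → A i m ≢ 1ℤ) →
    ¬ (∃ λ j′ → j₀ < j′ × j′ < j ×
        (∃ λ k → i < k × A k j′ ≡ 1ℤ × (∀ m → i < m → m < k → A m j′ ≡ 0ℤ)))
lemma3p6 A asm gapless i j j₀ Aij≡-1 _ Aij₀≡1 no-one (j′ , j₀<j′ , j′<j , k , i<k , Akj′≡1 , zeros) =
  first-nonzero-below-not-one asm j′ B-i-j′≡1 i<k Akj′≡1 zeros
  where
  B-i-j′≡1 : colPrefix A (suc (toℕ i)) (toℕ j′) ≡ 1ℤ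
  B-i-j′≡1 = B-row≡1-between asm gapless Aij≡-1 Aij₀≡1 no-one j′ (<⇒≤ j₀<j′) j′<j
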